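{- Let $n$ be a positive integer, $k=\lceil\log_3 n\rceil$, and let $m$ be an integer with $n\le m<3^k<3n$. Suppose that $m=2^r$ with $r$ a positive integer. Then there exist integers $1\le a<b\le n$ such that $b^3+b\equiv a^3+a\pmod{m}$.
   Context: $\lceil x\rceil$ denotes the smallest integer no less than $x$. -}

module Defs where

open import Data.Nat using (ℕ; _≤_; _<_; _^_)

IsCeilLog3 : ℕ → ℕ → Set
IsCeilLog3 n k = (n ≤ 3 ^ k) × (∀ j → j < k → 3 ^ j < n)
  where open import Data.Product using (_×_)

{-# OPTIONS --safe #-}
module Submission where

open import Defs
open import Data.Nat using (ℕ; _≤_; _<_; _^_; _*_) renaming (_+_ to _+ℕ_)
open import Data.Product using (Σ; _×_; ∃-syntax)
open import Data.Integer using (ℤ; +_; _-_)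
open import Data.Integer.Divisibility using (_∣_)
open import Relation.Binary.PropositionalEquality using (_≡_)

open import Data.Nat using (zero; suc; s≤s; _∸_)
open import Data.Nat.Properties
open import Data.Nat.Tactic.RingSolver using (solve-∀)
import Data.Nat.Divisibility as ℕ
open import Data.Integer using (∣_∣; _⊖_)
open import Data.Integer.Properties using ([+m]-[+n]≡m⊖n; ∣m⊖n∣≡∣n⊖m∣; ∣⊖∣-≤)
open import Data.Product using (_,_)
open import Relation.Binary.PropositionalEquality using (refl; sym; trans; cong; subst; module ≡-Reasoning)

-- With b = 1 + m/4 and a = 1, one has b³ + b − 2 = (b − 1)(b² + b + 2), and for m = 16t
-- the second factor is 4(1 + 3t + 4t²); so m divides the difference as soon as 16 ∣ m.
-- The bound 3n > m then gives b ≤ n. For m ∈ {2, 4, 8} the pair a = 1, b = 2 works,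
-- since 2³ + 2 − 2 = 8.

+d∣+[m+n]-+m : ∀ {d} m n → d ℕ.∣ n → + d ∣ (+ (m +ℕ n)) - (+ m)
+d∣+[m+n]-+m {d} m n d∣n = subst (d ℕ.∣_) (sym ∣[m+n]-m∣≡n) d∣n
  where
  open ≡-Reasoning
  ∣[m+n]-m∣≡n : ∣ (+ (m +ℕ n)) - (+ m) ∣ ≡ n
  ∣[m+n]-m∣≡n = begin
    ∣ (+ (m +ℕ n)) - (+ m) ∣  ≡⟨ cong ∣_∣ ([+m]-[+n]≡m⊖n (m +ℕ n) m) ⟩
    ∣ (m +ℕ n) ⊖ m ∣          ≡⟨ ∣m⊖n∣≡∣n⊖m∣ (m +ℕ n) m ⟩
    ∣ m ⊖ (m +ℕ n) ∣          ≡⟨ ∣⊖∣-≤ (m≤m+n m n) ⟩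
    m +ℕ n ∸ m                ≡⟨ m+n∸m≡n m n ⟩
    n                         ∎

[1+4t]³+[1+4t]≡2+16t[1+3t+4t²] : ∀ t →
  (1 +ℕ 4 * t) ^ 3 +ℕ (1 +ℕ 4 * t) ≡ 2 +ℕ 16 * t * (1 +ℕ 3 * t +ℕ 4 * (t * t))
[1+4t]³+[1+4t]≡2+16t[1+3t+4t²] = expanded
  where
  -- the ring solver does not reflect _^_, so the cube is written out as it normalises
  expanded : ∀ t → (1 +ℕ 4 * t) * ((1 +ℕ 4 * t) * ((1 +ℕ 4 * t) * 1)) +ℕ (1 +ℕ 4 * t)
                   ≡ 2 +ℕ 16 * t * (1 +ℕ 3 * t +ℕ 4 * (t * t))
  expanded = solve-∀

16t∣[1+4t]³+[1+4t]-2 : ∀ t → (+ (16 * t)) ∣ ((+ ((1 +ℕ 4 * t) ^ 3 +ℕ (1 +ℕ 4 * t))) - (+ 2))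
16t∣[1+4t]³+[1+4t]-2 t =
  subst (λ x → (+ (16 * t)) ∣ ((+ x) - (+ 2))) (sym ([1+4t]³+[1+4t]≡2+16t[1+3t+4t²] t))
    (+d∣+[m+n]-+m 2 _ (ℕ.m∣m*n (1 +ℕ 3 * t +ℕ 4 * (t * t))))

4x<3n⇒x<n : ∀ x n → 4 * x < 3 * n → x < n
4x<3n⇒x<n x n 4x<3n = *-cancelˡ-< 3 x n (≤-<-trans (*-monoˡ-≤ x (n≤1+n 3)) 4x<3n)

3ᵏ-between⇒1<n : ∀ {m n} k → 0 < m → m < 3 ^ k → 3 ^ k < 3 * n → 1 < n
3ᵏ-between⇒1<n zero    (s≤s _) (s≤s ()) _
3ᵏ-between⇒1<n {n = n} (suc k) _ _ 3ᵏ⁺¹<3n =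
  *-cancelˡ-< 3 1 n (≤-<-trans (*-monoʳ-≤ 3 (m^n>0 3 k)) 3ᵏ⁺¹<3n)

partner-of-1 : ∀ r n → 1 ≤ r → 1 < n → 2 ^ r < 3 * n →
  ∃[ b ] (1 < b × b ≤ n × (+ (2 ^ r)) ∣ ((+ (b ^ 3 +ℕ b)) - (+ 2)))
partner-of-1 1 _ _ 1<n _ = 2 , ≤-refl , 1<n , +d∣+[m+n]-+m 2 8 (ℕ.divides 4 refl)
partner-of-1 2 _ _ 1<n _ = 2 , ≤-refl , 1<n , +d∣+[m+n]-+m 2 8 (ℕ.divides 2 refl)
partner-of-1 3 _ _ 1<n _ = 2 , ≤-refl , 1<n , +d∣+[m+n]-+m 2 8 (ℕ.divides 1 refl)
partner-of-1 (suc (suc (suc (suc s)))) n _ _ 2ʳ<3n =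
  1 +ℕ 4 * t , 1<1+4t , 4t<n , subst (λ d → (+ d) ∣ b³+b-2) (sym 2ʳ≡16t) (16t∣[1+4t]³+[1+4t]-2 t)
  where
  t : ℕ
  t = 2 ^ s
  b³+b-2 : ℤ
  b³+b-2 = (+ ((1 +ℕ 4 * t) ^ 3 +ℕ (1 +ℕ 4 * t))) - (+ 2)
  2ʳ≡16t : 2 ^ (4 +ℕ s) ≡ 16 * t
  2ʳ≡16t = ^-distribˡ-+-* 2 4 s
  1<1+4t : 1 < 1 +ℕ 4 * t
  1<1+4t = s≤s (≤-trans (m^n>0 2 s) (m≤n*m t 4))
  4t<n : 4 * t < n
  4t<n = 4x<3n⇒x<n (4 * t) n (subst (_< 3 * n) (trans 2ʳ≡16t (*-assoc 4 4 t)) 2ʳ<3n)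

lemma4p2 : (n k m r : ℕ) → 1 ≤ n → IsCeilLog3 n k →
    n ≤ m → m < 3 ^ k → 3 ^ k < 3 * n →
    1 ≤ r → m ≡ 2 ^ r →
    ∃[ a ] ∃[ b ] (1 ≤ a × a < b × b ≤ n ×
      (+ m) ∣ ((+ (b ^ 3 +ℕ b)) - (+ (a ^ 3 +ℕ a))))
lemma4p2 n k m r 1≤n _ n≤m m<3ᵏ 3ᵏ<3n 1≤r refl
  with partner-of-1 r n 1≤r (3ᵏ-between⇒1<n k (≤-trans 1≤n n≤m) m<3ᵏ 3ᵏ<3n) (<-trans m<3ᵏ 3ᵏ<3n)
... | b , 1<b , b≤n , 2ʳ∣b³+b-2 = 1 , b , ≤-refl , 1<b , b≤n , 2ʳ∣b³+b-2
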